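{- For any integer $\gamma \geq 0$ and any $\mathsf{Zin}_\gamma$-algebra $\mathcal{Z}$, the binary operations $\diamond_a$, $a \in [\gamma]$, defined for all elements $x$ and $y$ of $\mathcal{Z}$ by \begin{equation} x \diamond_a y := x \mathbin{\sqcup\!\sqcup}_a y + y \mathbin{\sqcup\!\sqcup}_a x, \qquad a \in [\gamma], \end{equation} endow $\mathcal{Z}$ with a $\mathsf{Com}_\gamma$-algebra structure.
   Context: The ground field has characteristic zero, $[\gamma] = \{1, \dots, \gamma\}$, and $a \downarrow a'$ denotes $\min(a, a')$. A $\mathsf{Zin}_\gamma$-algebra is a vector space $\mathcal{Z}$ with binary operations $\mathbin{\sqcup\!\sqcup}_a$, $a \in [\gamma]$, satisfying for all $x, y, z \in \mathcal{Z}$ and $a, a' \in [\gamma]$: $(x \mathbin{\sqcup\!\sqcup}_{a'} y) \mathbin{\sqcup\!\sqcup}_a z = x \mathbin{\sqcup\!\sqcup}_{a \downarrow a'} (y \mathbin{\sqcup\!\sqcup}_a z) + x \mathbin{\sqcup\!\sqcup}_{a \downarrow a'} (z \mathbin{\sqcup\!\sqcup}_{a'} y)$. A $\mathsf{Com}_\gamma$-algebra is a vector space $\mathcal{C}$ with binary operations $\diamond_a$, $a \in [\gamma]$, satisfying for all $x, y, z$ and $a \in [\gamma]$: $x \diamond_a y = y \diamond_a x$ and $(x \diamond_a y) \diamond_a z = x \diamond_a (y \diamond_a z)$. -}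

module Defs where

open import Level using (Level; _⊔_)
open import Data.Nat using (ℕ; suc)
open import Data.Fin using (Fin)
import Data.Fin as Fin
open import Data.Product using (Σ; _,_)
open import Relation.Nullary using (¬_)
open import Algebra.Bundles using (CommutativeRing)
open import Algebra.Module.Bundles using (Module)
open import Algebra.Properties.Semiring.Mult using () renaming (_×_ to _·×_)

record IsCharZeroField {c ℓ : Level} (K : CommutativeRing c ℓ) : Set (c ⊔ ℓ) where
  open CommutativeRing K
  field
    1≉0     : ¬ (1# ≈ 0#)
    inverse : ∀ x → ¬ (x ≈ 0#) → Σ Carrier (λ y → x * y ≈ 1#)
    char0   : ∀ (n : ℕ) → ¬ (_·×_ semiring (suc n) 1# ≈ 0#)

_↓_ : {γ : ℕ} → Fin γ → Fin γ → Fin γ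
_↓_ {suc γ} Fin.zero    _           = Fin.zero
_↓_ {suc γ} (Fin.suc a) Fin.zero    = Fin.zero
_↓_ {suc γ} (Fin.suc a) (Fin.suc b) = Fin.suc (a ↓ b)

module _ {c ℓ m ℓm : Level} {K : CommutativeRing c ℓ} (V : Module K m ℓm) where
  open CommutativeRing K using () renaming (Carrier to Scalar)
  open Module V

  record IsBilinear (_·_ : Carrierᴹ → Carrierᴹ → Carrierᴹ) : Set (c ⊔ m ⊔ ℓm) where
    field
      cong   : ∀ {x x' y y'} → x ≈ᴹ x' → y ≈ᴹ y' → (x · y) ≈ᴹ (x' · y')
      distʳ  : ∀ x y z → ((x +ᴹ y) · z) ≈ᴹ ((x · z) +ᴹ (y · z))
      distˡ  : ∀ x y z → (x · (y +ᴹ z)) ≈ᴹ ((x · y) +ᴹ (x · z))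
      scaleˡ : ∀ (k : Scalar) x y → ((k *ₗ x) · y) ≈ᴹ (k *ₗ (x · y))
      scaleʳ : ∀ (k : Scalar) x y → (x · (k *ₗ y)) ≈ᴹ (k *ₗ (x · y))

  record IsZinAlgebra (γ : ℕ) (sh : Fin γ → Carrierᴹ → Carrierᴹ → Carrierᴹ)
         : Set (c ⊔ m ⊔ ℓm) where
    field
      bilinear : ∀ a → IsBilinear (sh a)
      zinbiel  : ∀ (a a' : Fin γ) x y z →
        sh a (sh a' x y) z ≈ᴹ (sh (a ↓ a') x (sh a y z) +ᴹ sh (a ↓ a') x (sh a' z y))

  record IsComAlgebra (γ : ℕ) (dm : Fin γ → Carrierᴹ → Carrierᴹ → Carrierᴹ)
         : Set (c ⊔ m ⊔ ℓm) where
    field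
      bilinear : ∀ a → IsBilinear (dm a)
      comm     : ∀ (a : Fin γ) x y → dm a x y ≈ᴹ dm a y x
      assoc    : ∀ (a : Fin γ) x y z → dm a (dm a x y) z ≈ᴹ dm a x (dm a y z)

module Submission where

-- Idea: at a = a' the Zinbiel relation reads (x ⧢ y) ⧢ z = x ⧢ (y ⋄ z), since a ↓ a = a.
-- Expanding (x ⋄ y) ⋄ z with this relation gives x ⧢ (y ⋄ z) + y ⧢ (x ⋄ z) + z ⧢ (x ⋄ y),
-- which is symmetric in x, y, z; commutativity of ⋄ is immediate from its definition.

open import Defs
open import Level using (Level)
open import Data.Nat using (ℕ; suc)
open import Data.Fin using (Fin; zero; suc)
open import Algebra.Bundles using (CommutativeRing; CommutativeMonoid)
open import Algebra.Module.Bundles using (Module)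
import Algebra.Properties.CommutativeSemigroup as CommutativeSemigroupProperties
open import Relation.Binary.PropositionalEquality using (_≡_; refl; cong)
import Relation.Binary.Reasoning.Setoid as SetoidReasoning

↓-idem : {γ : ℕ} (a : Fin γ) → a ↓ a ≡ a
↓-idem {suc γ} zero    = refl
↓-idem {suc γ} (suc a) = cong suc (↓-idem a)

module Symmetrization {c ℓ m ℓm : Level} {K : CommutativeRing c ℓ} (V : Module K m ℓm)
  (_·_ : Module.Carrierᴹ V → Module.Carrierᴹ V → Module.Carrierᴹ V)
  (·-bilinear : IsBilinear V _·_) where

  open Module V
  open IsBilinear ·-bilinear renaming (cong to ·-cong)
  open CommutativeSemigroupProperties
    (CommutativeMonoid.commutativeSemigroup +ᴹ-commutativeMonoid) using (interchange)
  open SetoidReasoning ≈ᴹ-setoid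

  infixl 7 _⋄_
  _⋄_ : Carrierᴹ → Carrierᴹ → Carrierᴹ
  x ⋄ y = (x · y) +ᴹ (y · x)

  ⋄-comm : ∀ x y → x ⋄ y ≈ᴹ y ⋄ x
  ⋄-comm x y = +ᴹ-comm (x · y) (y · x)

  ⋄-bilinear : IsBilinear V _⋄_
  ⋄-bilinear = record
    { cong   = λ x≈x' y≈y' → +ᴹ-cong (·-cong x≈x' y≈y') (·-cong y≈y' x≈x')
    ; distʳ  = λ x y z → ≈ᴹ-trans (+ᴹ-cong (distʳ x y z) (distˡ z x y)) (interchange _ _ _ _)
    ; distˡ  = λ x y z → ≈ᴹ-trans (+ᴹ-cong (distˡ x y z) (distʳ y z x)) (interchange _ _ _ _)
    ; scaleˡ = λ k x y → ≈ᴹ-trans (+ᴹ-cong (scaleˡ k x y) (scaleʳ k y x)) (≈ᴹ-sym (*ₗ-distribˡ k _ _))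
    ; scaleʳ = λ k x y → ≈ᴹ-trans (+ᴹ-cong (scaleʳ k x y) (scaleˡ k y x)) (≈ᴹ-sym (*ₗ-distribˡ k _ _))
    }

  module _ (right-zinbiel : ∀ x y z → (x · y) · z ≈ᴹ x · (y ⋄ z)) where

    ⋄-expand : ∀ x y z → (x ⋄ y) ⋄ z ≈ᴹ x · (y ⋄ z) +ᴹ (y · (z ⋄ x) +ᴹ z · (y ⋄ x))
    ⋄-expand x y z = begin
      (x · y +ᴹ y · x) · z +ᴹ z · (x ⋄ y)            ≈⟨ +ᴹ-congʳ (distʳ (x · y) (y · x) z) ⟩
      ((x · y) · z +ᴹ (y · x) · z) +ᴹ z · (x ⋄ y)    ≈⟨ +ᴹ-congʳ (+ᴹ-cong (right-zinbiel x y z) (right-zinbiel y x z)) ⟩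
      (x · (y ⋄ z) +ᴹ y · (x ⋄ z)) +ᴹ z · (x ⋄ y)    ≈⟨ +ᴹ-assoc _ _ _ ⟩
      x · (y ⋄ z) +ᴹ (y · (x ⋄ z) +ᴹ z · (x ⋄ y))    ≈⟨ +ᴹ-congˡ (+ᴹ-cong (·-cong ≈ᴹ-refl (⋄-comm x z))
                                                                          (·-cong ≈ᴹ-refl (⋄-comm x y))) ⟩
      x · (y ⋄ z) +ᴹ (y · (z ⋄ x) +ᴹ z · (y ⋄ x))    ∎

    ⋄-assoc : ∀ x y z → (x ⋄ y) ⋄ z ≈ᴹ x ⋄ (y ⋄ z)
    ⋄-assoc x y z = begin
      (x ⋄ y) ⋄ z                                  ≈⟨ ⋄-expand x y z ⟩
      x · (y ⋄ z) +ᴹ (y · (z ⋄ x) +ᴹ z · (y ⋄ x))  ≈⟨ +ᴹ-congˡ (+ᴹ-cong (≈ᴹ-sym (right-zinbiel y z x))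
                                                                        (≈ᴹ-sym (right-zinbiel z y x))) ⟩
      x · (y ⋄ z) +ᴹ ((y · z) · x +ᴹ (z · y) · x)  ≈⟨ +ᴹ-congˡ (≈ᴹ-sym (distʳ (y · z) (z · y) x)) ⟩
      x ⋄ (y ⋄ z)                                  ∎

module _ {c ℓ m ℓm : Level} {K : CommutativeRing c ℓ} {V : Module K m ℓm} {γ : ℕ}
  {sh : Fin γ → Module.Carrierᴹ V → Module.Carrierᴹ V → Module.Carrierᴹ V}
  (Z : IsZinAlgebra V γ sh) where

  open Module V
  open IsZinAlgebra Z

  zinbiel-diagonal : ∀ a x y z → sh a (sh a x y) z ≈ᴹ sh a x (sh a y z +ᴹ sh a z y)
  zinbiel-diagonal a x y z with zinbiel a a x y z
  ... | relation rewrite ↓-idem a =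
    ≈ᴹ-trans relation (≈ᴹ-sym (IsBilinear.distˡ (bilinear a) x (sh a y z) (sh a z y)))

proposition4p3p1 : {c ℓ m ℓm : Level} (K : CommutativeRing c ℓ) → IsCharZeroField K →
    (V : Module K m ℓm) → (γ : ℕ) →
    (sh : Fin γ → Module.Carrierᴹ V → Module.Carrierᴹ V → Module.Carrierᴹ V) →
    IsZinAlgebra V γ sh →
    IsComAlgebra V γ (λ a x y → Module._+ᴹ_ V (sh a x y) (sh a y x))
proposition4p3p1 K _ V γ sh Z = record
  { bilinear = λ a → Symmetrization.⋄-bilinear V (sh a) (bilinear a)
  ; comm     = λ a → Symmetrization.⋄-comm V (sh a) (bilinear a)
  ; assoc    = λ a → Symmetrization.⋄-assoc V (sh a) (bilinear a) (zinbiel-diagonal Z a)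
  }
  where open IsZinAlgebra Z
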